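{- Let $G=(U\cup W,E)$ be a non-trivial circular graph. Then $d(x)\ge 3$ for every $x\in U$.
   Context: All graphs are finite and simple. For vertices $v_1,\dots,v_k$, $cn(v_1,\dots,v_k)$ denotes the number of common neighbours of $v_1,\dots,v_k$. A circular graph is a finite bipartite graph $G$ with a specified bipartition $V(G)=U\cup W$ into nonempty sets ($U\cap W=\emptyset$, every edge joins $U$ to $W$) such that (i) $cn(u_i,u_j,u_k)=1$ for all distinct $u_i,u_j,u_k\in U$, and (ii) $d(w)\ge 3$ for every $w\in W$. It is trivial if $|U|=1$ or $|W|=1$, and non-trivial otherwise (so $|U|\ge 2$ and $|W|\ge 2$). -}

module Defs where

open import Data.Nat using (ℕ; zero; suc; _+_; _≤_; _≥_)
open import Data.Fin using (Fin; zero; suc)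
open import Data.Bool using (Bool; true; false; _∧_)
open import Data.Product using (_×_)
open import Relation.Binary.PropositionalEquality using (_≡_; _≢_)

count : ∀ {k} → (Fin k → Bool) → ℕ
count {zero}  p = 0
count {suc k} p = if′ (p zero) + count (λ i → p (suc i))
  where
  if′ : Bool → ℕ
  if′ true  = 1
  if′ false = 0

-- A finite simple bipartite graph with a specified bipartition U ∪ W,
-- U = Fin m, W = Fin n, edges given by adjacency adj u w (every edge joins U to W).
record BipartiteGraph : Set where
  field
    m   : ℕ
    n   : ℕ
    adj : Fin m → Fin n → Bool

open BipartiteGraph public

degU : (G : BipartiteGraph) → Fin (m G) → ℕ
degU G u = count (λ w → adj G u w)

degW : (G : BipartiteGraph) → Fin (n G) → ℕ
degW G w = count (λ u → adj G u w)

cn3 : (G : BipartiteGraph) → Fin (m G) → Fin (m G) → Fin (m G) → ℕ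
cn3 G a b c = count (λ w → adj G a w ∧ adj G b w ∧ adj G c w)

record IsCircular (G : BipartiteGraph) : Set where
  field
    U-nonempty : 1 ≤ m G
    W-nonempty : 1 ≤ n G
    cn-one     : (a b c : Fin (m G)) → a ≢ b → a ≢ c → b ≢ c → cn3 G a b c ≡ 1
    degW≥3     : (w : Fin (n G)) → degW G w ≥ 3

NonTrivial : BipartiteGraph → Set
NonTrivial G = (2 ≤ m G) × (2 ≤ n G)

-- Two distinct vertices of W cannot share three neighbours (these would be two common
-- neighbours of one triple), so no vertex of W is adjacent to all of U. Suppose x had a
-- neighbour w₁ and at most one other neighbour. Pick a ∉ N(w₁); then a ≠ x, and for every
-- u ∉ {x, a} the common neighbour of x, a, u lies in N(x) ∖ {w₁}, so it is one fixed
-- vertex w. But then w is adjacent to all of U.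
module Submission where

open import Data.Bool using (Bool; true; false; not; _∧_; T)
open import Data.Bool.Properties using (T-∧)
open import Data.Empty using (⊥-elim)
open import Data.Fin using (Fin; zero; suc; punchIn)
open import Data.Fin.Properties using (_≟_; ¬∀⟶∃¬; punchInᵢ≢i)
open import Data.Nat using (ℕ; zero; suc; _≤_; _≥_; z≤n; s≤s; _≤?_)
open import Data.Nat.Properties using (≤-pred; ≤-trans)
open import Data.Product using (∃; ∃-syntax; _×_; _,_; proj₁; proj₂)
open import Function using (_∘_)
open import Function.Bundles using (Equivalence)
open import Relation.Nullary using (¬_; yes; no; does; contradiction)
open import Relation.Nullary.Decidable using (T?)
open import Relation.Binary.PropositionalEquality using (_≡_; _≢_; refl; sym; cong; subst)

open import Defs

Distinct₃ : ∀ {A : Set} → A → A → A → Set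
Distinct₃ a b c = a ≢ b × a ≢ c × b ≢ c

other : ∀ {k} → 2 ≤ k → (i : Fin k) → ∃ λ j → j ≢ i
other {suc zero}    (s≤s ())
other {suc (suc _)} _ i = punchIn i zero , punchInᵢ≢i i zero

avoid₂ : ∀ {k} {t₁ t₂ t₃ : Fin k} → Distinct₃ t₁ t₂ t₃ →
         (a b : Fin k) → ∃ λ c → c ≢ a × c ≢ b
avoid₂ {t₁ = t₁} {t₂} {t₃} (t₁≢t₂ , t₁≢t₃ , t₂≢t₃) a b with t₁ ≟ a | t₁ ≟ b
... | no t₁≢a | no t₁≢b = t₁ , t₁≢a , t₁≢b
... | yes refl | _ with t₂ ≟ b
...   | no t₂≢b  = t₂ , t₁≢t₂ ∘ sym , t₂≢b
...   | yes refl = t₃ , t₁≢t₃ ∘ sym , t₂≢t₃ ∘ sym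
avoid₂ {t₁ = t₁} {t₂} {t₃} (t₁≢t₂ , t₁≢t₃ , t₂≢t₃) a b | no _ | yes refl with t₂ ≟ a
...   | no t₂≢a  = t₂ , t₂≢a , t₁≢t₂ ∘ sym
...   | yes refl = t₃ , t₂≢t₃ ∘ sym , t₁≢t₃ ∘ sym

module _ {k : ℕ} where

  _─_ : (Fin k → Bool) → Fin k → Fin k → Bool
  (p ─ i) j = not (does (j ≟ i)) ∧ p j

  ─-T⁺ : ∀ (p : Fin k → Bool) {i j} → j ≢ i → T (p j) → T ((p ─ i) j)
  ─-T⁺ p {i} {j} j≢i pj with j ≟ i
  ... | yes j≡i = contradiction j≡i j≢i
  ... | no _    = pj

  ─-T⁻ : ∀ (p : Fin k → Bool) {i j} → T ((p ─ i) j) → j ≢ i × T (p j)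
  ─-T⁻ p {i} {j} h with j ≟ i
  ... | no j≢i = j≢i , h

count-─ : ∀ {k} (p : Fin k → Bool) {i} → T (p i) → count p ≡ suc (count (p ─ i))
count-─ p {zero} pi with p zero
... | true = refl
count-─ p {suc i} pi with p zero
... | true  = cong suc (count-─ (p ∘ suc) pi)
... | false = count-─ (p ∘ suc) pi

count-suc⁺ : ∀ {k r} (p : Fin k → Bool) {i} → T (p i) → r ≤ count (p ─ i) → suc r ≤ count p
count-suc⁺ p pi h = subst (_ ≤_) (sym (count-─ p pi)) (s≤s h)

count-pos⁺ : ∀ {k} (p : Fin k → Bool) {i} → T (p i) → 1 ≤ count p
count-pos⁺ p pi = count-suc⁺ p pi z≤n

count-pos⁻ : ∀ {k} (p : Fin k → Bool) → 1 ≤ count p → ∃ λ i → T (p i)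
count-pos⁻ {suc k} p h with p zero in eq
... | true  = zero , subst T (sym eq) _
... | false = let i , pi = count-pos⁻ (p ∘ suc) h in suc i , pi

count-suc⁻ : ∀ {k r} (p : Fin k → Bool) → suc r ≤ count p →
             ∃ λ i → T (p i) × r ≤ count (p ─ i)
count-suc⁻ p h =
  let i , pi = count-pos⁻ p (≤-trans (s≤s z≤n) h)
  in  i , pi , ≤-pred (subst (_ ≤_) (count-─ p pi) h)

count≥2⁺ : ∀ {k} (p : Fin k → Bool) {i j} → i ≢ j → T (p i) → T (p j) → 2 ≤ count p
count≥2⁺ p i≢j pi pj = count-suc⁺ p pi (count-pos⁺ (p ─ _) (─-T⁺ p (i≢j ∘ sym) pj))

count≥3⁺ : ∀ {k} (p : Fin k → Bool) {i j l} → Distinct₃ i j l →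
           T (p i) → T (p j) → T (p l) → 3 ≤ count p
count≥3⁺ p (i≢j , i≢l , j≢l) pi pj pl =
  count-suc⁺ p pi (count≥2⁺ (p ─ _) j≢l (─-T⁺ p (i≢j ∘ sym) pj) (─-T⁺ p (i≢l ∘ sym) pl))

count≥3⁻ : ∀ {k} (p : Fin k → Bool) → 3 ≤ count p →
           ∃[ i ] ∃[ j ] ∃[ l ] Distinct₃ i j l × T (p i) × T (p j) × T (p l)
count≥3⁻ p h with count-suc⁻ p h
... | i , pi , h₂ with count-suc⁻ (p ─ i) h₂
... | j , p─ij , h₁ with count-pos⁻ ((p ─ i) ─ j) h₁
... | l , p─ijl with ─-T⁻ p p─ij | ─-T⁻ (p ─ i) p─ijl
... | j≢i , pj | l≢j , p─il with ─-T⁻ p p─il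
... | l≢i , pl = i , j , l , (j≢i ∘ sym , l≢i ∘ sym , l≢j ∘ sym) , pi , pj , pl

count<3⇒unique-other : ∀ {k} (p : Fin k → Bool) → ¬ 3 ≤ count p →
                       ∀ {i j l} → T (p i) → j ≢ i → l ≢ i → T (p j) → T (p l) → j ≡ l
count<3⇒unique-other p count≱3 {j = j} {l} pi j≢i l≢i pj pl with j ≟ l
... | yes j≡l = j≡l
... | no j≢l  = contradiction (count≥3⁺ p (j≢i ∘ sym , l≢i ∘ sym , j≢l) pi pj pl) count≱3

module Circular {G : BipartiteGraph} (circ : IsCircular G) (nontrivial : NonTrivial G) where
  open IsCircular circ

  _~_ : Fin (m G) → Fin (n G) → Set
  u ~ w = T (adj G u w)

  neighbours₃ : (w : Fin (n G)) → ∃[ a ] ∃[ b ] ∃[ c ] Distinct₃ a b c × a ~ w × b ~ w × c ~ w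
  neighbours₃ w = count≥3⁻ (λ u → adj G u w) (degW≥3 w)

  fresh : (a b : Fin (m G)) → ∃ λ c → c ≢ a × c ≢ b
  fresh = let _ , _ , _ , distinct , _ = neighbours₃ (Fin-nonempty W-nonempty) in avoid₂ distinct
    where
    Fin-nonempty : ∀ {k} → 1 ≤ k → Fin k
    Fin-nonempty (s≤s _) = zero

  common-neighbour : ∀ {a b c} → Distinct₃ a b c → ∃ λ w → a ~ w × b ~ w × c ~ w
  common-neighbour {a} {b} {c} (a≢b , a≢c , b≢c) =
    let w , abc~w = count-pos⁻ _ (subst (1 ≤_) (sym (cn-one a b c a≢b a≢c b≢c)) (s≤s z≤n))
        a~w , bc~w = Equivalence.to T-∧ abc~w
    in  w , a~w , Equivalence.to T-∧ bc~w

  common-neighbour-unique : ∀ {a b c w w′} → Distinct₃ a b c →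
                            a ~ w → b ~ w → c ~ w → a ~ w′ → b ~ w′ → c ~ w′ → w ≡ w′
  common-neighbour-unique {a} {b} {c} {w} {w′} (a≢b , a≢c , b≢c) a~w b~w c~w a~w′ b~w′ c~w′
    with w ≟ w′
  ... | yes w≡w′ = w≡w′
  ... | no w≢w′  = contradiction
    (subst (2 ≤_) (cn-one a b c a≢b a≢c b≢c)
      (count≥2⁺ _ w≢w′ (all~ a~w b~w c~w) (all~ a~w′ b~w′ c~w′)))
    λ { (s≤s ()) }
    where
    all~ : ∀ {v} → a ~ v → b ~ v → c ~ v → T (adj G a v ∧ adj G b v ∧ adj G c v)
    all~ a~v b~v c~v = Equivalence.from T-∧ (a~v , Equivalence.from T-∧ (b~v , c~v))

  has-neighbour : (x : Fin (m G)) → ∃ λ w → x ~ w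
  has-neighbour x =
    let y , y≢x , _ = fresh x x
        z , z≢x , z≢y = fresh x y
        w , x~w , _ = common-neighbour (y≢x ∘ sym , z≢x ∘ sym , z≢y ∘ sym)
    in  w , x~w

  no-universal-neighbour : (w : Fin (n G)) → ¬ (∀ u → u ~ w)
  no-universal-neighbour w all~w =
    let w′ , w′≢w = other (proj₂ nontrivial) w
        a , b , c , abc , a~w′ , b~w′ , c~w′ = neighbours₃ w′
    in  w′≢w (common-neighbour-unique abc a~w′ b~w′ c~w′ (all~w a) (all~w b) (all~w c))

  non-neighbour : (w : Fin (n G)) → ∃ λ u → ¬ u ~ w
  non-neighbour w = ¬∀⟶∃¬ _ _ (λ u → T? (adj G u w)) (no-universal-neighbour w)

  ¬at-most-one-other-neighbour :
    ∀ {x w₁} → x ~ w₁ →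
    ¬ (∀ {w w′} → w ≢ w₁ → w′ ≢ w₁ → x ~ w → x ~ w′ → w ≡ w′)
  ¬at-most-one-other-neighbour {x} {w₁} x~w₁ unique =
    let b , b≢x , b≢a = fresh x a
        w , w≢w₁ , x~w , a~w , _ = other-common-neighbour b≢x b≢a
    in  no-universal-neighbour w (universal w≢w₁ x~w a~w)
    where
    a : Fin (m G)
    a = proj₁ (non-neighbour w₁)

    a≁w₁ : ¬ a ~ w₁
    a≁w₁ = proj₂ (non-neighbour w₁)

    a≢x : a ≢ x
    a≢x refl = a≁w₁ x~w₁

    other-common-neighbour : ∀ {u} → u ≢ x → u ≢ a →
                             ∃ λ w → w ≢ w₁ × x ~ w × a ~ w × u ~ w
    other-common-neighbour u≢x u≢a =
      let w , x~w , a~w , u~w = common-neighbour (a≢x ∘ sym , u≢x ∘ sym , u≢a ∘ sym)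
      in  w , a≁w₁ ∘ (λ w≡w₁ → subst (a ~_) w≡w₁ a~w) , x~w , a~w , u~w

    universal : ∀ {w} → w ≢ w₁ → x ~ w → a ~ w → ∀ u → u ~ w
    universal w≢w₁ x~w a~w u with u ≟ x | u ≟ a
    ... | yes refl | _        = x~w
    ... | no _     | yes refl = a~w
    ... | no u≢x   | no u≢a   =
      let w′ , w′≢w₁ , x~w′ , _ , u~w′ = other-common-neighbour u≢x u≢a
      in  subst (u ~_) (unique w′≢w₁ w≢w₁ x~w′ x~w) u~w′

lemma2p5 : (G : BipartiteGraph) → IsCircular G → NonTrivial G →
           (x : Fin (m G)) → degU G x ≥ 3
lemma2p5 G circ nontrivial x with 3 ≤? degU G x
... | yes deg≥3 = deg≥3
... | no deg≱3  =
  let w₁ , x~w₁ = has-neighbour x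
  in  ⊥-elim (¬at-most-one-other-neighbour x~w₁
                (count<3⇒unique-other (adj G x) deg≱3 x~w₁))
  where open Circular circ nontrivial
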